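{- Let $\phi$ be an independence logic formula with $\mathrm{Free}_T(\phi) = \bar x$, and let $R$ be a $|\bar x|$-ary relation symbol not occurring in $\phi$. Then $\phi$ is valid in entailment semantics if and only if $\models_{R\bar x} \phi$.
   Context: Entailment semantics $M\models_{\gamma(h)}\phi$ is defined for: - a first-order formula $\gamma(\bar x,\bar p)$, whose free variables split into team variables $\bar x$ and parameter variables $\bar p$; - a parameter assignment $h$; - an independence logic formula $\phi$ in negation normal form, built from literals, atoms $\bar t_2\perp_{\bar t_1}\bar t_3$, $\wedge,\vee,\exists,\forall$. It is equivalent to satisfaction of $\phi$ by the team $\{s:\mathrm{Dom}(s)=\bar x,M\models_{h\cup s}\gamma\}$ in the least general model over $M$. In the least general model, disjunction and existential quantification may only use teams first-order definable in $M$ with element parameters. $\phi$ is valid in entailment semantics iff $M\models_{\gamma(h)}\phi$ for all $M$ whose signature contains that of $\phi$, all first-order $\gamma(\bar x,\bar p)$ over that signature and all $h$ with domain $\bar p$. $\models_\gamma\phi$ means $M\models_{\gamma(h)}\phi$ for all $M$ whose signature contains those of $\gamma$ and $\phi$, and all $h$ with domain $\mathrm{Free}_P(\gamma)$. -}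

module Defs where

open import Data.Nat using (ℕ; _≟_; _≡ᵇ_)
open import Data.Bool using (if_then_else_)
open import Data.List using (List; []; _∷_; _++_; filter; length; map)
open import Data.Vec using (Vec; []; _∷_; fromList)
import Data.Vec as V
open import Data.Product using (Σ; _×_; _,_)
open import Data.Sum using (_⊎_)
open import Data.Empty using (⊥)
open import Relation.Nullary using (¬_; ¬?)
open import Relation.Binary.PropositionalEquality using (_≡_)

-- We use a single universal
-- vocabulary: a function symbol / relation symbol is a pair
-- (arity n , name k) with n k : ℕ.  Constants are 0-ary function symbols.

data Term : Set where
  var : ℕ → Term
  fn  : (n k : ℕ) → Vec Term n → Term

data FO : Set where
  rel : (n k : ℕ) → Vec Term n → FO
  eq  : Term → Term → FO
  neg : FO → FO
  and or : FO → FO → FO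
  ex all : ℕ → FO → FO

-- independence logic formulas in negation normal form
-- indep t₁ t₂ t₃  stands for the atom  t₂ ⊥_{t₁} t₃
data IL : Set where
  rel⁺ rel⁻ : (n k : ℕ) → Vec Term n → IL
  eq⁺ eq⁻   : Term → Term → IL
  indep     : List Term → List Term → List Term → IL
  and or    : IL → IL → IL
  ex all    : ℕ → IL → IL

mutual
  varsT : Term → List ℕ
  varsT (var x) = x ∷ []
  varsT (fn n k ts) = varsV ts

  varsV : ∀ {m} → Vec Term m → List ℕ
  varsV [] = []
  varsV (t ∷ ts) = varsT t ++ varsV ts

varsL : List Term → List ℕ
varsL [] = []
varsL (t ∷ ts) = varsT t ++ varsL ts

remove : ℕ → List ℕ → List ℕ
remove v = filter (λ y → ¬? (y ≟ v))

freeVars : IL → List ℕ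
freeVars (rel⁺ n k ts) = varsV ts
freeVars (rel⁻ n k ts) = varsV ts
freeVars (eq⁺ t u) = varsT t ++ varsT u
freeVars (eq⁻ t u) = varsT t ++ varsT u
freeVars (indep a b c) = varsL a ++ varsL b ++ varsL c
freeVars (and φ ψ) = freeVars φ ++ freeVars ψ
freeVars (or φ ψ) = freeVars φ ++ freeVars ψ
freeVars (ex v φ) = remove v (freeVars φ)
freeVars (all v φ) = remove v (freeVars φ)

OccursRel : ℕ → ℕ → IL → Set
OccursRel n r (rel⁺ m k ts) = (m ≡ n) × (k ≡ r)
OccursRel n r (rel⁻ m k ts) = (m ≡ n) × (k ≡ r)
OccursRel n r (eq⁺ t u) = ⊥
OccursRel n r (eq⁻ t u) = ⊥
OccursRel n r (indep a b c) = ⊥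
OccursRel n r (and φ ψ) = OccursRel n r φ ⊎ OccursRel n r ψ
OccursRel n r (or φ ψ) = OccursRel n r φ ⊎ OccursRel n r ψ
OccursRel n r (ex v φ) = OccursRel n r φ
OccursRel n r (all v φ) = OccursRel n r φ

Rx : ℕ → (xs : List ℕ) → FO
Rx r xs = rel (length xs) r (V.map var (fromList xs))

-- Structures (interpreting every symbol of the universal vocabulary;
-- domains are nonempty).

record Structure : Set₁ where
  field
    Carrier : Set
    elem    : Carrier
    funI    : (n k : ℕ) → Vec Carrier n → Carrier
    relI    : (n k : ℕ) → Vec Carrier n → Set

module Semantics (M : Structure) where
  open Structure M

  -- assignments are total; only values on the relevant variables matter
  Asg : Set
  Asg = ℕ → Carrier

  update : Asg → ℕ → Carrier → Asg
  update s v a n = if n ≡ᵇ v then a else s n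

  merge : List ℕ → Asg → Asg → Asg
  merge [] s g = g
  merge (d ∷ D) s g = update (merge D s g) d (s d)

  mutual
    evalT : Asg → Term → Carrier
    evalT s (var x) = s x
    evalT s (fn n k ts) = funI n k (evalV s ts)

    evalV : ∀ {m} → Asg → Vec Term m → Vec Carrier m
    evalV s [] = []
    evalV s (t ∷ ts) = evalT s t ∷ evalV s ts

  evalL : Asg → List Term → List Carrier
  evalL s [] = []
  evalL s (t ∷ ts) = evalT s t ∷ evalL s ts

  sat : FO → Asg → Set
  sat (rel n k ts) s = relI n k (evalV s ts)
  sat (eq t u) s = evalT s t ≡ evalT s u
  sat (neg θ) s = ¬ sat θ s
  sat (and θ ψ) s = sat θ s × sat ψ s
  sat (or θ ψ) s = sat θ s ⊎ sat ψ s
  sat (ex v θ) s = Σ Carrier λ a → sat θ (update s v a)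
  sat (all v θ) s = (a : Carrier) → sat θ (update s v a)

  Team : Set₁
  Team = Asg → Set

  defTeam : List ℕ → FO → Asg → Team
  defTeam D θ g t = sat θ (merge D t g)

  -- team semantics in the least general model over M, for a team with
  -- domain D: disjunction and existential quantification may only use
  -- teams that are first-order definable in M with element parameters.
  tsat : List ℕ → IL → Team → Set
  tsat D (rel⁺ n k ts) X = ∀ s → X s → relI n k (evalV s ts)
  tsat D (rel⁻ n k ts) X = ∀ s → X s → ¬ relI n k (evalV s ts)
  tsat D (eq⁺ t u) X = ∀ s → X s → evalT s t ≡ evalT s u
  tsat D (eq⁻ t u) X = ∀ s → X s → ¬ (evalT s t ≡ evalT s u)
  tsat D (indep t₁ t₂ t₃) X =
    ∀ s s′ → X s → X s′ → evalL s t₁ ≡ evalL s′ t₁ →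
    Σ Asg λ s″ → X s″ × (evalL s″ t₁ ≡ evalL s t₁)
                      × (evalL s″ t₂ ≡ evalL s t₂)
                      × (evalL s″ t₃ ≡ evalL s′ t₃)
  tsat D (and φ ψ) X = tsat D φ X × tsat D ψ X
  tsat D (or φ ψ) X =
    Σ FO λ θ₁ → Σ Asg λ g₁ → Σ FO λ θ₂ → Σ Asg λ g₂ →
      (∀ s → X s → defTeam D θ₁ g₁ s ⊎ defTeam D θ₂ g₂ s)
      × (∀ s → defTeam D θ₁ g₁ s → X s)
      × (∀ s → defTeam D θ₂ g₂ s → X s)
      × tsat D φ (defTeam D θ₁ g₁)
      × tsat D ψ (defTeam D θ₂ g₂)
  -- X[F/v] = Y for some F with nonempty values, Y definable
  tsat D (ex v φ) X =
    Σ FO λ θ → Σ Asg λ g →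
      (∀ t → defTeam (v ∷ D) θ g t → Σ Carrier λ a → X (update t v a))
      × (∀ s → X s → Σ Carrier λ a → defTeam (v ∷ D) θ g (update s v a))
      × tsat (v ∷ D) φ (defTeam (v ∷ D) θ g)
  tsat D (all v φ) X =
    tsat (v ∷ D) φ (λ t → Σ Carrier λ a → X (update t v a))

  -- entailment semantics  M ⊨_{γ(h)} φ  with team variables xs:
  -- the team {s : Dom(s) = xs, M ⊨_{h ∪ s} γ} satisfies φ in the
  -- least general model over M.
  entails : FO → Asg → List ℕ → IL → Set
  entails γ h xs φ = tsat xs φ (λ s → sat γ (merge xs s h))

ValidEnt : List ℕ → IL → Set₁
ValidEnt xs φ =
  (M : Structure) (γ : FO) (h : ℕ → Structure.Carrier M) →
  Semantics.entails M γ h xs φ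

-- ⊨_γ φ (with team variables xs); since assignments are total, the
-- values of h outside Free_P(γ) are irrelevant
EntailedBy : FO → List ℕ → IL → Set₁
EntailedBy γ xs φ =
  (M : Structure) (h : ℕ → Structure.Carrier M) →
  Semantics.entails M γ h xs φ

module Submission where

-- (⇒) is the instance γ := R x̄ of validity.
-- (⇐) Given M, γ and parameters h, let M' be M with R reinterpreted as the
-- relation  {w | M ⊨ γ[w/x̄, h]}.  The team of R x̄ in M' is the team of γ in
-- M, so it suffices to move satisfaction of φ from the least general model
-- over M' to the one over M.  Since R does not occur in φ, the atoms of φ
-- mean the same in M and M'; the only difference lies in the teams that
-- disjunction and ∃ may use, which are those definable with parameters.
-- So the heart of the proof is that every team definable in M' is also
-- definable in M: replace each atom R t̄ by γ[t̄/x̄], placing the parameters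
-- h of γ and its bound variables above all variables of the formula (shift
-- by N) so that the substitution is capture-free.

open import Defs
open import Data.Nat using (ℕ; suc; _≟_; _≡ᵇ_; _<ᵇ_; _<_; _≤_; _+_; _∸_; _⊔_)
open import Data.Nat.Properties
  using (≡ᵇ⇒≡; ≡⇒≡ᵇ; ≟-diag; <⇒<ᵇ; <ᵇ⇒<; <⇒≱; m≤n+m; m+n∸n≡m; +-cancelʳ-≡;
         m≤m⊔n; m≤n⊔m; ≤-trans)
open import Data.Bool using (true; false; T; if_then_else_)
open import Data.Unit using (tt)
open import Data.List using (List; []; _∷_; _++_; length; foldr)
open import Data.List.Membership.Propositional using (_∈_; _∉_)
open import Data.List.Membership.Propositional.Properties using (∈-++⁺ˡ; ∈-++⁺ʳ)
open import Data.List.Relation.Unary.Any using (here; there; tail)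
open import Data.List.Relation.Unary.Unique.Propositional using (Unique)
open import Data.Vec using (Vec; []; _∷_; fromList)
import Data.Vec as V
open import Data.Product using (Σ; _×_; _,_)
open import Data.Product.Function.NonDependent.Propositional using (_×-⇔_)
open import Data.Sum using (_⊎_; inj₁; inj₂)
import Data.Sum as Sum
open import Data.Sum.Function.Propositional using (_⊎-⇔_)
open import Data.Empty using (⊥-elim)
open import Function using (_∘_)
open import Function.Bundles using (_⇔_; mk⇔; Equivalence)
open import Function.Properties.Equivalence
  using () renaming (refl to ⇔-refl; sym to ⇔-sym; trans to ⇔-trans)
open import Function.Related.TypeIsomorphisms using (¬-cong-⇔)
open import Relation.Nullary using (¬_; Dec; yes; no)
open import Relation.Nullary.Decidable using (_×-dec_)
open import Relation.Binary.PropositionalEquality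

open Equivalence using (to; from)

Σ-cong-⇔ : {C : Set} {A B : C → Set} → (∀ c → A c ⇔ B c) → Σ C A ⇔ Σ C B
Σ-cong-⇔ A⇔B = mk⇔ (λ (c , a) → c , to (A⇔B c) a) (λ (c , b) → c , from (A⇔B c) b)

Π-cong-⇔ : {C : Set} {A B : C → Set} → (∀ c → A c ⇔ B c) →
           ((c : C) → A c) ⇔ ((c : C) → B c)
Π-cong-⇔ A⇔B = mk⇔ (λ f c → to (A⇔B c) (f c)) (λ g c → from (A⇔B c) (g c))

≡⇒⇔ : {A B : Set} → A ≡ B → A ⇔ B
≡⇒⇔ refl = ⇔-refl

infixl 9 _[_↦_]
_[_↦_] : {A : Set} → (ℕ → A) → ℕ → A → ℕ → A
(f [ v ↦ a ]) u = if u ≡ᵇ v then a else f u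

≡ᵇ-false⇒≢ : ∀ u v → (u ≡ᵇ v) ≡ false → u ≢ v
≡ᵇ-false⇒≢ u _ e refl = subst T e (≡⇒≡ᵇ u u refl)

↦-same : {A : Set} (f : ℕ → A) (v : ℕ) (a : A) → (f [ v ↦ a ]) v ≡ a
↦-same f v a with v ≡ᵇ v in e
... | true = refl
... | false = ⊥-elim (≡ᵇ-false⇒≢ v v e refl)

↦-other : {A : Set} (f : ℕ → A) (v : ℕ) (a : A) {u : ℕ} → u ≢ v → (f [ v ↦ a ]) u ≡ f u
↦-other f v a {u} u≢v with u ≡ᵇ v in e
... | true = ⊥-elim (u≢v (≡ᵇ⇒≡ u v (subst T (sym e) tt)))
... | false = refl

↦-cong : {A : Set} (f g : ℕ → A) (v : ℕ) {a b : A} (u : ℕ) →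
         a ≡ b → (u ≢ v → f u ≡ g u) → (f [ v ↦ a ]) u ≡ (g [ v ↦ b ]) u
↦-cong f g v u a≡b f≡g with u ≡ᵇ v in e
... | true = a≡b
... | false = f≡g (≡ᵇ-false⇒≢ u v e)

↦-map : {A B : Set} (F : A → B) (f : ℕ → A) (v : ℕ) (a : A) (u : ℕ) →
        F ((f [ v ↦ a ]) u) ≡ ((F ∘ f) [ v ↦ F a ]) u
↦-map F f v a u with u ≡ᵇ v
... | true = refl
... | false = refl

-- Simultaneous override: fill ys w g sends yᵢ to wᵢ (first occurrence
-- wins) and agrees with g off ys.  It interprets a substitution x̄ := w.
fill : {A : Set} (ys : List ℕ) → Vec A (length ys) → (ℕ → A) → ℕ → A
fill [] [] g = g
fill (y ∷ ys) (a ∷ w) g = fill ys w g [ y ↦ a ]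

fill-cong : {A : Set} (ys : List ℕ) (w : Vec A (length ys)) {g g' : ℕ → A} →
            (∀ u → g u ≡ g' u) → ∀ u → fill ys w g u ≡ fill ys w g' u
fill-cong [] [] g≗g' u = g≗g' u
fill-cong (y ∷ ys) (a ∷ w) {g} {g'} g≗g' u = ↦-cong (fill ys w g) (fill ys w g') y u refl (λ _ → fill-cong ys w g≗g' u)

Agree : {A : Set} → (ℕ → A) → (ℕ → A) → List ℕ → Set
Agree s s' vs = ∀ {u} → u ∈ vs → s u ≡ s' u

agree-update : {A : Set} {s s' : ℕ → A} {v : ℕ} {vs : List ℕ} (a : A) →
               Agree s s' (v ∷ vs) → Agree (s [ v ↦ a ]) (s' [ v ↦ a ]) vs
agree-update {s = s} {s'} {v} a agree {u} p = ↦-cong s s' v u refl (λ _ → agree (there p))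

sup : List ℕ → ℕ
sup = foldr (λ v m → suc v ⊔ m) 0

∈⇒<sup : ∀ {u} vs → u ∈ vs → u < sup vs
∈⇒<sup (v ∷ vs) (here refl) = m≤m⊔n (suc v) (sup vs)
∈⇒<sup (v ∷ vs) (there p) = ≤-trans (∈⇒<sup vs p) (m≤n⊔m (suc v) (sup vs))

allVars : FO → List ℕ
allVars (rel n k ts) = varsV ts
allVars (eq t u) = varsT t ++ varsT u
allVars (neg θ) = allVars θ
allVars (and θ ψ) = allVars θ ++ allVars ψ
allVars (or θ ψ) = allVars θ ++ allVars ψ
allVars (ex v θ) = v ∷ allVars θ
allVars (all v θ) = v ∷ allVars θ

Bounded : ℕ → FO → Set
Bounded N θ = ∀ {u} → u ∈ allVars θ → u < N

-- Capture-free substitution.  substF N σ θ renames every bound variable v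
-- of θ to v + N; this avoids capture as long as σ is N-shifted: the term
-- σ v only mentions variables below N and possibly v + N itself.

mutual
  substT : (ℕ → Term) → Term → Term
  substT σ (var x) = σ x
  substT σ (fn n k ts) = fn n k (substV σ ts)

  substV : ∀ {m} → (ℕ → Term) → Vec Term m → Vec Term m
  substV σ [] = []
  substV σ (t ∷ ts) = substT σ t ∷ substV σ ts

substF : ℕ → (ℕ → Term) → FO → FO
substF N σ (rel n k ts) = rel n k (substV σ ts)
substF N σ (eq t u) = eq (substT σ t) (substT σ u)
substF N σ (neg θ) = neg (substF N σ θ)
substF N σ (and θ ψ) = and (substF N σ θ) (substF N σ ψ)
substF N σ (or θ ψ) = or (substF N σ θ) (substF N σ ψ)
substF N σ (ex v θ) = ex (v + N) (substF N (σ [ v ↦ var (v + N) ]) θ)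
substF N σ (all v θ) = all (v + N) (substF N (σ [ v ↦ var (v + N) ]) θ)

Shifted : ℕ → (ℕ → Term) → Set
Shifted N σ = ∀ v {u} → u ∈ varsT (σ v) → u < N ⊎ u ≡ v + N

shifted-update : ∀ {N σ} v → Shifted N σ → Shifted N (σ [ v ↦ var (v + N) ])
shifted-update {N} {σ} v shifted u {w} p with u ≟ v
... | yes refl = inj₂ (at-binder (subst (λ t → w ∈ varsT t) (↦-same σ u (var (u + N))) p))
  where
  at-binder : w ∈ u + N ∷ [] → w ≡ u + N
  at-binder (here w≡) = w≡
... | no u≢v = shifted u (subst (λ t → w ∈ varsT t) (↦-other σ v (var (v + N)) u≢v) p)

fill-vars : (ys : List ℕ) (ts : Vec Term (length ys)) (τ : ℕ → Term) (v : ℕ) →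
            ∀ {u} → u ∈ varsT (fill ys ts τ v) → u ∈ varsV ts ⊎ u ∈ varsT (τ v)
fill-vars [] [] τ v p = inj₂ p
fill-vars (y ∷ ys) (t ∷ ts) τ v {u} p with v ≟ y
... | yes refl = inj₁ (∈-++⁺ˡ (subst (λ t' → u ∈ varsT t') (↦-same (fill ys ts τ) v t) p))
... | no v≢y = Sum.map₁ (∈-++⁺ʳ (varsT t))
                 (fill-vars ys ts τ v (subst (λ t' → u ∈ varsT t') (↦-other (fill ys ts τ) y t v≢y) p))

module Coincidence (M : Structure) where
  open Structure M
  open Semantics M

  mutual
    evalT-coincide : ∀ {s s'} t → Agree s s' (varsT t) → evalT s t ≡ evalT s' t
    evalT-coincide (var x) agree = agree (here refl)
    evalT-coincide (fn n k ts) agree = cong (funI n k) (evalV-coincide ts agree)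

    evalV-coincide : ∀ {m s s'} (ts : Vec Term m) → Agree s s' (varsV ts) → evalV s ts ≡ evalV s' ts
    evalV-coincide [] agree = refl
    evalV-coincide (t ∷ ts) agree =
      cong₂ _∷_ (evalT-coincide t (λ p → agree (∈-++⁺ˡ p)))
                (evalV-coincide ts (λ p → agree (∈-++⁺ʳ (varsT t) p)))

  sat-coincide : ∀ θ {s s'} → Agree s s' (allVars θ) → sat θ s ⇔ sat θ s'
  sat-coincide (rel n k ts) agree = ≡⇒⇔ (cong (relI n k) (evalV-coincide ts agree))
  sat-coincide (eq t u) agree =
    ≡⇒⇔ (cong₂ _≡_ (evalT-coincide t (λ p → agree (∈-++⁺ˡ p)))
                   (evalT-coincide u (λ p → agree (∈-++⁺ʳ (varsT t) p))))
  sat-coincide (neg θ) agree = ¬-cong-⇔ (sat-coincide θ agree)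
  sat-coincide (and θ ψ) agree =
    sat-coincide θ (λ p → agree (∈-++⁺ˡ p)) ×-⇔ sat-coincide ψ (λ p → agree (∈-++⁺ʳ (allVars θ) p))
  sat-coincide (or θ ψ) agree =
    sat-coincide θ (λ p → agree (∈-++⁺ˡ p)) ⊎-⇔ sat-coincide ψ (λ p → agree (∈-++⁺ʳ (allVars θ) p))
  sat-coincide (ex v θ) agree = Σ-cong-⇔ λ a → sat-coincide θ (agree-update a agree)
  sat-coincide (all v θ) agree = Π-cong-⇔ λ a → sat-coincide θ (agree-update a agree)

  sat-≗ : ∀ θ {s s'} → (∀ u → s u ≡ s' u) → sat θ s ⇔ sat θ s'
  sat-≗ θ s≗s' = sat-coincide θ (λ {u} _ → s≗s' u)

  evalV-vars : ∀ s {m} (vs : Vec ℕ m) → evalV s (V.map var vs) ≡ V.map s vs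
  evalV-vars s [] = refl
  evalV-vars s (v ∷ vs) = cong (s v ∷_) (evalV-vars s vs)

  merge-∈ : ∀ D t g {u} → u ∈ D → merge D t g u ≡ t u
  merge-∈ (d ∷ D) t g {u} p with u ≟ d
  ... | yes refl = ↦-same (merge D t g) u (t u)
  ... | no u≢d = trans (↦-other (merge D t g) d (t d) u≢d) (merge-∈ D t g (tail u≢d p))

  merge-∉ : ∀ D t g {u} → u ∉ D → merge D t g u ≡ g u
  merge-∉ [] t g u∉D = refl
  merge-∉ (d ∷ D) t g u∉D =
    trans (↦-other (merge D t g) d (t d) (u∉D ∘ here)) (merge-∉ D t g (u∉D ∘ there))

  merge-param : ∀ D t {g g'} u → g u ≡ g' u → merge D t g u ≡ merge D t g' u
  merge-param [] t u g≡g' = g≡g'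
  merge-param (d ∷ D) t {g} {g'} u g≡g' = ↦-cong (merge D t g) (merge D t g') d u refl (λ _ → merge-param D t u g≡g')

  fill-merge : ∀ ys {m s} g → Agree m s ys →
               ∀ u → fill ys (V.map m (fromList ys)) g u ≡ merge ys s g u
  fill-merge [] g agree u = refl
  fill-merge (y ∷ ys) {m} {s} g agree u =
    ↦-cong (fill ys (V.map m (fromList ys)) g) (merge ys s g) y u (agree (here refl)) (λ _ → fill-merge ys g (λ p → agree (there p)) u)

module Substitution (M : Structure) where
  open Structure M
  open Semantics M
  open Coincidence M

  mutual
    evalT-subst : ∀ σ s t → evalT s (substT σ t) ≡ evalT (evalT s ∘ σ) t
    evalT-subst σ s (var x) = refl
    evalT-subst σ s (fn n k ts) = cong (funI n k) (evalV-subst σ s ts)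

    evalV-subst : ∀ {m} σ s (ts : Vec Term m) → evalV s (substV σ ts) ≡ evalV (evalT s ∘ σ) ts
    evalV-subst σ s [] = refl
    evalV-subst σ s (t ∷ ts) = cong₂ _∷_ (evalT-subst σ s t) (evalV-subst σ s ts)

  evalT-fill : ∀ s (ys : List ℕ) (ts : Vec Term (length ys)) τ u →
               evalT s (fill ys ts τ u) ≡ fill ys (evalV s ts) (evalT s ∘ τ) u
  evalT-fill s [] [] τ u = refl
  evalT-fill s (y ∷ ys) (t ∷ ts) τ u =
    trans (↦-map (evalT s) (fill ys ts τ) y t u) (↦-cong (evalT s ∘ fill ys ts τ) (fill ys (evalV s ts) (evalT s ∘ τ)) y u refl
                                                    (λ _ → evalT-fill s ys ts τ u))

  -- Binding v + N on the substituted side corresponds to binding v on the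
  -- original side; this is where N-shiftedness is used.
  eval-under-binder : ∀ N σ v s a → Shifted N σ → ∀ u →
    evalT (s [ v + N ↦ a ]) ((σ [ v ↦ var (v + N) ]) u) ≡ ((evalT s ∘ σ) [ v ↦ a ]) u
  eval-under-binder N σ v s a shifted u with u ≟ v
  ... | yes refl = begin
      evalT (s [ u + N ↦ a ]) ((σ [ u ↦ var (u + N) ]) u)
        ≡⟨ cong (evalT (s [ u + N ↦ a ])) (↦-same σ u (var (u + N))) ⟩
      (s [ u + N ↦ a ]) (u + N)  ≡⟨ ↦-same s (u + N) a ⟩
      a                          ≡⟨ ↦-same (evalT s ∘ σ) u a ⟨
      ((evalT s ∘ σ) [ u ↦ a ]) u ∎
    where open ≡-Reasoning
  ... | no u≢v = begin
      evalT (s [ v + N ↦ a ]) ((σ [ v ↦ var (v + N) ]) u)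
        ≡⟨ cong (evalT (s [ v + N ↦ a ])) (↦-other σ v (var (v + N)) u≢v) ⟩
      evalT (s [ v + N ↦ a ]) (σ u) ≡⟨ evalT-coincide (σ u) binder-fresh ⟩
      evalT s (σ u)                 ≡⟨ ↦-other (evalT s ∘ σ) v a u≢v ⟨
      ((evalT s ∘ σ) [ v ↦ a ]) u ∎
    where
    open ≡-Reasoning
    binder-fresh : Agree (s [ v + N ↦ a ]) s (varsT (σ u))
    binder-fresh p with shifted u p
    ... | inj₁ w<N = ↦-other s (v + N) a (λ w≡ → <⇒≱ w<N (subst (N ≤_) (sym w≡) (m≤n+m N v)))
    ... | inj₂ refl = ↦-other s (v + N) a (u≢v ∘ +-cancelʳ-≡ N u v)

  mutual
    substF-sem : ∀ N θ σ s → Shifted N σ → sat (substF N σ θ) s ⇔ sat θ (evalT s ∘ σ)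
    substF-sem N (rel n k ts) σ s shifted = ≡⇒⇔ (cong (relI n k) (evalV-subst σ s ts))
    substF-sem N (eq t u) σ s shifted = ≡⇒⇔ (cong₂ _≡_ (evalT-subst σ s t) (evalT-subst σ s u))
    substF-sem N (neg θ) σ s shifted = ¬-cong-⇔ (substF-sem N θ σ s shifted)
    substF-sem N (and θ ψ) σ s shifted = substF-sem N θ σ s shifted ×-⇔ substF-sem N ψ σ s shifted
    substF-sem N (or θ ψ) σ s shifted = substF-sem N θ σ s shifted ⊎-⇔ substF-sem N ψ σ s shifted
    substF-sem N (ex v θ) σ s shifted = Σ-cong-⇔ (under-binder N θ σ v s shifted)
    substF-sem N (all v θ) σ s shifted = Π-cong-⇔ (under-binder N θ σ v s shifted)

    under-binder : ∀ N θ σ v s → Shifted N σ → ∀ a →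
      sat (substF N (σ [ v ↦ var (v + N) ]) θ) (s [ v + N ↦ a ]) ⇔ sat θ ((evalT s ∘ σ) [ v ↦ a ])
    under-binder N θ σ v s shifted a =
      ⇔-trans (substF-sem N θ (σ [ v ↦ var (v + N) ]) (s [ v + N ↦ a ]) (shifted-update v shifted))
              (sat-≗ θ (eval-under-binder N σ v s a shifted))

module Expansion (M : Structure) (L r : ℕ) (P : Vec (Structure.Carrier M) L → Set) where
  open Structure M
  module S = Semantics M

  isR? : (n k : ℕ) → Dec (n ≡ L × k ≡ r)
  isR? n k = (n ≟ L) ×-dec (k ≟ r)

  expRel : (n k : ℕ) → Dec (n ≡ L × k ≡ r) → Vec Carrier n → Set
  expRel n k (yes (refl , refl)) w = P w
  expRel n k (no _) w = relI n k w

  M' : Structure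
  M' = record M { relI = λ n k → expRel n k (isR? n k) }

  module S' = Semantics M'

  relI'-R : ∀ w → Structure.relI M' L r w ≡ P w
  relI'-R w rewrite ≟-diag (refl {x = L}) | ≟-diag (refl {x = r}) = refl

  mutual
    evalT-expand : ∀ s t → S'.evalT s t ≡ S.evalT s t
    evalT-expand s (var x) = refl
    evalT-expand s (fn n k ts) = cong (funI n k) (evalV-expand s ts)

    evalV-expand : ∀ {m} s (ts : Vec Term m) → S'.evalV s ts ≡ S.evalV s ts
    evalV-expand s [] = refl
    evalV-expand s (t ∷ ts) = cong₂ _∷_ (evalT-expand s t) (evalV-expand s ts)

  evalL-expand : ∀ s ts → S'.evalL s ts ≡ S.evalL s ts
  evalL-expand s [] = refl
  evalL-expand s (t ∷ ts) = cong₂ _∷_ (evalT-expand s t) (evalL-expand s ts)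

  merge-expand : ∀ D t g u → S'.merge D t g u ≡ S.merge D t g u
  merge-expand [] t g u = refl
  merge-expand (d ∷ D) t g u = ↦-cong (S'.merge D t g) (S.merge D t g) d u refl (λ _ → merge-expand D t g u)

  atom-unchanged : ∀ {n k} → ¬ (n ≡ L × k ≡ r) → ∀ s (ts : Vec Term n) →
                   Structure.relI M' n k (S'.evalV s ts) ⇔ relI n k (S.evalV s ts)
  atom-unchanged {n} {k} notR s ts with isR? n k
  ... | yes isR = ⊥-elim (notR isR)
  ... | no _ = ≡⇒⇔ (cong (relI n k) (evalV-expand s ts))

  evalL-unchanged : ∀ s s′ ts → (S'.evalL s ts ≡ S'.evalL s′ ts) ⇔ (S.evalL s ts ≡ S.evalL s′ ts)
  evalL-unchanged s s′ ts = ≡⇒⇔ (cong₂ _≡_ (evalL-expand s ts) (evalL-expand s′ ts))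

  eq-unchanged : ∀ s t u → (S'.evalT s t ≡ S'.evalT s u) ⇔ (S.evalT s t ≡ S.evalT s u)
  eq-unchanged s t u = ≡⇒⇔ (cong₂ _≡_ (evalT-expand s t) (evalT-expand s u))

  _≈ₜ_ : S'.Team → S.Team → Set
  X ≈ₜ Y = ∀ s → X s ⇔ Y s

  DefinableInM : Set
  DefinableInM = ∀ D θ g → Σ FO λ θ* → Σ S.Asg λ g* → S'.defTeam D θ g ≈ₜ S.defTeam D θ* g*

  transfer : DefinableInM → ∀ D φ → ¬ OccursRel L r φ →
             ∀ {X Y} → X ≈ₜ Y → S'.tsat D φ X → S.tsat D φ Y
  transfer define D (rel⁺ n k ts) notR X≈Y H s y =
    to (atom-unchanged notR s ts) (H s (from (X≈Y s) y))
  transfer define D (rel⁻ n k ts) notR X≈Y H s y q =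
    H s (from (X≈Y s) y) (from (atom-unchanged notR s ts) q)
  transfer define D (eq⁺ t u) notR X≈Y H s y = to (eq-unchanged s t u) (H s (from (X≈Y s) y))
  transfer define D (eq⁻ t u) notR X≈Y H s y q = H s (from (X≈Y s) y) (from (eq-unchanged s t u) q)
  transfer define D (indep t₁ t₂ t₃) notR X≈Y H s s′ y y′ e
    with H s s′ (from (X≈Y s) y) (from (X≈Y s′) y′) (from (evalL-unchanged s s′ t₁) e)
  ... | s″ , x″ , e₁ , e₂ , e₃ =
    s″ , to (X≈Y s″) x″ ,
    to (evalL-unchanged s″ s t₁) e₁ , to (evalL-unchanged s″ s t₂) e₂ , to (evalL-unchanged s″ s′ t₃) e₃
  transfer define D (and φ ψ) notR X≈Y (Hφ , Hψ) =
    transfer define D φ (notR ∘ inj₁) X≈Y Hφ , transfer define D ψ (notR ∘ inj₂) X≈Y Hψ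
  transfer define D (or φ ψ) notR X≈Y (θ₁ , g₁ , θ₂ , g₂ , cover , sub₁ , sub₂ , Hφ , Hψ)
    with define D θ₁ g₁ | define D θ₂ g₂
  ... | θ₁* , g₁* , same₁ | θ₂* , g₂* , same₂ =
    θ₁* , g₁* , θ₂* , g₂* ,
    (λ s y → Sum.map (to (same₁ s)) (to (same₂ s)) (cover s (from (X≈Y s) y))) ,
    (λ s p → to (X≈Y s) (sub₁ s (from (same₁ s) p))) ,
    (λ s p → to (X≈Y s) (sub₂ s (from (same₂ s) p))) ,
    transfer define D φ (notR ∘ inj₁) same₁ Hφ ,
    transfer define D ψ (notR ∘ inj₂) same₂ Hψ
  transfer define D (ex v φ) notR X≈Y (θ , g , into , onto , Hφ) with define (v ∷ D) θ g
  ... | θ* , g* , same =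
    θ* , g* ,
    (λ t p → let (a , x) = into t (from (same t) p) in a , to (X≈Y _) x) ,
    (λ s y → let (a , q) = onto s (from (X≈Y s) y) in a , to (same _) q) ,
    transfer define (v ∷ D) φ notR same Hφ
  transfer define D (all v φ) notR X≈Y Hφ =
    transfer define (v ∷ D) φ notR (λ t → Σ-cong-⇔ λ a → X≈Y (t [ v ↦ a ])) Hφ

-- The expansion of M in which R x̄ is interpreted by γ with parameters h
-- has no more definable teams than M: a formula θ over the expansion is
-- translated by replacing every R t̄ with γ[t̄/x̄].

module Definability (M : Structure) (γ : FO) (h : ℕ → Structure.Carrier M) (xs : List ℕ) (r : ℕ) where
  open Structure M
  module C = Coincidence M
  open Substitution M

  L : ℕ
  L = length xs

  definedByγ : Vec Carrier L → Set
  definedByγ w = Semantics.sat M γ (fill xs w h)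

  open Expansion M L r definedByγ public
  module C' = Coincidence M'

  -- Variable v of γ becomes v + N; its value there is h v.
  shift : ℕ → ℕ → Term
  shift N v = var (v + N)

  trAtom : ℕ → (n k : ℕ) → Dec (n ≡ L × k ≡ r) → Vec Term n → FO
  trAtom N n k (yes (refl , refl)) ts = substF N (fill xs ts (shift N)) γ
  trAtom N n k (no _) ts = rel n k ts

  tr : ℕ → FO → FO
  tr N (rel n k ts) = trAtom N n k (isR? n k) ts
  tr N (eq t u) = eq t u
  tr N (neg θ) = neg (tr N θ)
  tr N (and θ ψ) = and (tr N θ) (tr N ψ)
  tr N (or θ ψ) = or (tr N θ) (tr N ψ)
  tr N (ex v θ) = ex v (tr N θ)
  tr N (all v θ) = all v (tr N θ)

  HighParams : ℕ → S.Asg → Set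
  HighParams N s = ∀ v → s (v + N) ≡ h v

  high-update : ∀ {N s} v a → v < N → HighParams N s → HighParams N (s [ v ↦ a ])
  high-update {N} {s} v a v<N high u =
    trans (↦-other s v a (λ eq → <⇒≱ v<N (subst (N ≤_) eq (m≤n+m N u)))) (high u)

  tr-atom-sem : ∀ N (ts : Vec Term L) s → (∀ {u} → u ∈ varsV ts → u < N) → HighParams N s →
                definedByγ (S'.evalV s ts) ⇔ S.sat (substF N (fill xs ts (shift N)) γ) s
  tr-atom-sem N ts s ts<N high =
    ⇔-trans (C.sat-≗ γ pointwise) (⇔-sym (substF-sem N γ (fill xs ts (shift N)) s shifted))
    where
    open ≡-Reasoning
    pointwise : ∀ u → fill xs (S'.evalV s ts) h u ≡ S.evalT s (fill xs ts (shift N) u)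
    pointwise u = begin
      fill xs (S'.evalV s ts) h u          ≡⟨ cong (λ w → fill xs w h u) (evalV-expand s ts) ⟩
      fill xs (S.evalV s ts) h u           ≡⟨ fill-cong xs (S.evalV s ts) (sym ∘ high) u ⟩
      fill xs (S.evalV s ts) (λ v → s (v + N)) u ≡⟨ evalT-fill s xs ts (shift N) u ⟨
      S.evalT s (fill xs ts (shift N) u)   ∎
    shifted : Shifted N (fill xs ts (shift N))
    shifted v p with fill-vars xs ts (shift N) v p
    ... | inj₁ in-ts = inj₁ (ts<N in-ts)
    ... | inj₂ (here u≡) = inj₂ u≡

  tr-sem : ∀ N θ s → Bounded N θ → HighParams N s → S'.sat θ s ⇔ S.sat (tr N θ) s
  tr-sem N (rel n k ts) s bounded high with isR? n k
  ... | yes (refl , refl) = tr-atom-sem N ts s bounded high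
  ... | no _ = ≡⇒⇔ (cong (relI n k) (evalV-expand s ts))
  tr-sem N (eq t u) s bounded high = eq-unchanged s t u
  tr-sem N (neg θ) s bounded high = ¬-cong-⇔ (tr-sem N θ s bounded high)
  tr-sem N (and θ ψ) s bounded high =
    tr-sem N θ s (bounded ∘ ∈-++⁺ˡ) high ×-⇔ tr-sem N ψ s (bounded ∘ ∈-++⁺ʳ (allVars θ)) high
  tr-sem N (or θ ψ) s bounded high =
    tr-sem N θ s (bounded ∘ ∈-++⁺ˡ) high ⊎-⇔ tr-sem N ψ s (bounded ∘ ∈-++⁺ʳ (allVars θ)) high
  tr-sem N (ex v θ) s bounded high = Σ-cong-⇔ λ a →
    tr-sem N θ (s [ v ↦ a ]) (bounded ∘ there) (high-update {N} {s} v a (bounded (here refl)) high)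
  tr-sem N (all v θ) s bounded high = Π-cong-⇔ λ a →
    tr-sem N θ (s [ v ↦ a ]) (bounded ∘ there) (high-update {N} {s} v a (bounded (here refl)) high)

  params : ℕ → S.Asg → S.Asg
  params N g v = if v <ᵇ N then g v else h (v ∸ N)

  params-below : ∀ N g v → v < N → g v ≡ params N g v
  params-below N g v v<N with v <ᵇ N in e
  ... | true = refl
  ... | false = ⊥-elim (subst T e (<⇒<ᵇ v<N))

  params-above : ∀ N g u → params N g (u + N) ≡ h u
  params-above N g u with (u + N) <ᵇ N in e
  ... | false = cong h (m+n∸n≡m u N)
  ... | true = ⊥-elim (<⇒≱ (<ᵇ⇒< (u + N) N (subst T (sym e) tt)) (m≤n+m N u))

  definable : DefinableInM
  definable D θ g = tr N θ , params N g , λ t →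
      ⇔-trans (C'.sat-coincide θ (agree t))
              (tr-sem N θ (S.merge D t (params N g)) bounded (high t))
    where
    N : ℕ
    N = sup (allVars θ ++ D)
    bounded : Bounded N θ
    bounded p = ∈⇒<sup (allVars θ ++ D) (∈-++⁺ˡ p)
    D<N : ∀ {u} → u ∈ D → u < N
    D<N p = ∈⇒<sup (allVars θ ++ D) (∈-++⁺ʳ (allVars θ) p)
    agree : ∀ t → Agree (S'.merge D t g) (S.merge D t (params N g)) (allVars θ)
    agree t {u} p = trans (merge-expand D t g u) (C.merge-param D t u (params-below N g u (bounded p)))
    high : ∀ t → HighParams N (S.merge D t (params N g))
    high t v = trans (C.merge-∉ D t (params N g) (λ p → <⇒≱ (D<N p) (m≤n+m N v))) (params-above N g v)

  team-of-Rx : (λ s → S'.sat (Rx r xs) (S'.merge xs s h)) ≈ₜ (λ s → S.sat γ (S.merge xs s h))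
  team-of-Rx s = ⇔-trans (≡⇒⇔ (trans (relI'-R _) (cong definedByγ (C'.evalV-vars m (fromList xs)))))
                         (C.sat-≗ γ (C.fill-merge xs h (C'.merge-∈ xs s h)))
    where
    m : S.Asg
    m = S'.merge xs s h

  entailment-transfer : ∀ φ → ¬ OccursRel L r φ → S'.entails (Rx r xs) h xs φ → S.entails γ h xs φ
  entailment-transfer φ notR = transfer definable xs φ notR team-of-Rx

mainTheorem18 : (φ : IL) (xs : List ℕ) (r : ℕ) →
    Unique xs →
    (∀ v → (v ∈ xs → v ∈ freeVars φ) × (v ∈ freeVars φ → v ∈ xs)) →
    ¬ OccursRel (length xs) r φ →
    (ValidEnt xs φ → EntailedBy (Rx r xs) xs φ)
      × (EntailedBy (Rx r xs) xs φ → ValidEnt xs φ)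
mainTheorem18 φ xs r _ _ notR = instantiate , reinterpret
  where
  instantiate : ValidEnt xs φ → EntailedBy (Rx r xs) xs φ
  instantiate valid M h = valid M (Rx r xs) h

  reinterpret : EntailedBy (Rx r xs) xs φ → ValidEnt xs φ
  reinterpret entailed M γ h =
    entailment-transfer φ notR (entailed M' h)
    where open Definability M γ h xs r
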